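{- A prime $p$ belongs to $\mathcal P$ if and only if the equation $x^2+216y^2=p^2$ has a solution $(x,y)\in\mathbb Z^2$ with $\gcd(x,y)=1$.
   Context: A solution $(x,y)\in\mathbb Z^2$ of a Diophantine equation is called primitive if $\gcd(x,y)=1$. $\mathcal P$ denotes the set of primes $p$ such that for some $j\in\{1,4,8\}$ the equation $x^2+216y^2=jp$ has a primitive solution. -}

module Defs where

open import Data.Nat using (ℕ)
open import Data.Nat.Primality using (Prime)
open import Data.Integer using (ℤ; +_; _+_; _*_)
open import Data.Integer.GCD using (gcd)
open import Data.Product using (_×_; ∃-syntax)
open import Data.Sum using (_⊎_)
open import Relation.Binary.PropositionalEquality using (_≡_)

PrimSol : ℤ → ℤ → ℤ → Set
PrimSol x y n = (x * x + + 216 * (y * y) ≡ n) × (gcd x y ≡ + 1)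

HasPrimSol : ℤ → Set
HasPrimSol n = ∃[ x ] ∃[ y ] PrimSol x y n

InP : ℕ → Set
InP p = Prime p × (HasPrimSol (+ p) ⊎ HasPrimSol (+ (4 Data.Nat.* p)) ⊎ HasPrimSol (+ (8 Data.Nat.* p)))

-- If p = α u² + β v² primitively with (α, β) one of (1, 216), (1, 54), (2, 27), then with
-- A = α u² and B = β v² the identity (A + B)² = (A − B)² + 4AB, where 4αβ is 4·216 or 216,
-- writes p² = X² + 216 y² primitively. Conversely, from p² = X² + 216 Y² the numbers
-- a = (p + X)/2 and b = (p − X)/2 are coprime with ab = 54 Y², so that {a, b} is {t², 54 s²}
-- or {2 s², 27 t²}, i.e. p = t² + 54 s² or p = 2 s² + 27 t². Finally, by parity,
-- x² + 216 y² = 4p and x² + 216 y² = 8p are primitively solvable exactly when p is primitively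
-- of the form x² + 54 y², respectively 2 x² + 27 y².
module Submission where

open import Defs
open import Data.Nat
open import Data.Nat.Properties
open import Data.Nat.Divisibility
open import Data.Nat.DivMod using (_/_; m/n*n≡m)
open import Data.Nat.GCD using (gcd; gcd[m,n]∣m; gcd[m,n]∣n; gcd[m,n]≢0)
open import Data.Nat.Coprimality
  using (Coprime; coprime-divisor; coprime-/gcd; prime⇒coprime; 0-coprimeTo-m⇒m≡1; gcd≡1⇒coprime; coprime⇒gcd≡1)
import Data.Nat.Coprimality as Coprime
open import Data.Nat.Primality using (Prime; prime?; euclidsLemma; prime⇒irreducible; ¬prime[1]; prime[2])
open import Data.Nat.Tactic.RingSolver using (solve-∀)
open import Data.Integer using (+_)
import Data.Integer as ℤ
import Data.Integer.Properties as ℤ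
open import Data.Product using (∃-syntax; _×_; _,_; proj₁; proj₂)
open import Data.Sum using (_⊎_; inj₁; inj₂; [_,_]′; swap)
import Data.Sum as Sum
open import Function.Base using (id)
open import Function.Bundles using (_⇔_; mk⇔; Equivalence)
open import Relation.Nullary using (¬_; yes; no; contradiction)
open import Relation.Nullary.Decidable using (from-yes; from-no)
open import Relation.Binary.PropositionalEquality

PrimitiveRep : ℕ → ℕ → ℕ → Set
PrimitiveRep α β n = ∃[ x ] ∃[ y ] (α * (x * x) + β * (y * y) ≡ n) × Coprime x y

hasPrimSol⇔primitiveRep : ∀ n → HasPrimSol (+ n) ⇔ PrimitiveRep 1 216 n
hasPrimSol⇔primitiveRep n = mk⇔ to from
  where
  i*i≡+∣i∣*∣i∣ : ∀ i → i ℤ.* i ≡ + (ℤ.∣ i ∣ * ℤ.∣ i ∣)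
  i*i≡+∣i∣*∣i∣ (+ m)      = ℤ.+◃n≡+n (m * m)
  i*i≡+∣i∣*∣i∣ ℤ.-[1+ m ] = ℤ.+◃n≡+n _

  form≡+form∣∣ : ∀ x y → x ℤ.* x ℤ.+ + 216 ℤ.* (y ℤ.* y)
                       ≡ + (1 * (ℤ.∣ x ∣ * ℤ.∣ x ∣) + 216 * (ℤ.∣ y ∣ * ℤ.∣ y ∣))
  form≡+form∣∣ x y = begin
    x ℤ.* x ℤ.+ + 216 ℤ.* (y ℤ.* y)
      ≡⟨ cong₂ (λ i j → i ℤ.+ + 216 ℤ.* j) (i*i≡+∣i∣*∣i∣ x) (i*i≡+∣i∣*∣i∣ y) ⟩
    + ∣x∣² ℤ.+ + 216 ℤ.* + ∣y∣²
      ≡⟨ cong (λ i → + ∣x∣² ℤ.+ i) (ℤ.pos-* 216 ∣y∣²) ⟨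
    + ∣x∣² ℤ.+ + (216 * ∣y∣²)
      ≡⟨ ℤ.pos-+ ∣x∣² _ ⟨
    + (∣x∣² + 216 * ∣y∣²)
      ≡⟨ cong (λ m → + (m + 216 * ∣y∣²)) (*-identityˡ ∣x∣²) ⟨
    + (1 * ∣x∣² + 216 * ∣y∣²) ∎
    where
    open ≡-Reasoning
    ∣x∣² = ℤ.∣ x ∣ * ℤ.∣ x ∣
    ∣y∣² = ℤ.∣ y ∣ * ℤ.∣ y ∣

  to : HasPrimSol (+ n) → PrimitiveRep 1 216 n
  to (x , y , eq , gcd≡1) =
    ℤ.∣ x ∣ , ℤ.∣ y ∣ , ℤ.+-injective (trans (sym (form≡+form∣∣ x y)) eq) ,
    gcd≡1⇒coprime (ℤ.+-injective gcd≡1)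

  from : PrimitiveRep 1 216 n → HasPrimSol (+ n)
  from (x , y , eq , x⊥y) =
    + x , + y , trans (form≡+form∣∣ (+ x) (+ y)) (cong +_ eq) , cong +_ (coprime⇒gcd≡1 x⊥y)

prime⇒≢1 : ∀ {p} → Prime p → p ≢ 1
prime⇒≢1 p-prime refl = ¬prime[1] p-prime

prime[3] : Prime 3
prime[3] = from-yes (prime? 3)

coprime-∣ : ∀ {m n d e} → Coprime m n → d ∣ m → e ∣ n → Coprime d e
coprime-∣ m⊥n d∣m e∣n (i∣d , i∣e) = m⊥n (∣-trans i∣d d∣m , ∣-trans i∣e e∣n)

coprime-*ʳ : ∀ {m n o} → Coprime m n → Coprime m o → Coprime m (n * o)
coprime-*ʳ m⊥n m⊥o (d∣m , d∣no) = m⊥o (d∣m , coprime-divisor (coprime-∣ m⊥n d∣m ∣-refl) d∣no)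

prime∤⇒coprime : ∀ {p n} → Prime p → ¬ p ∣ n → Coprime p n
prime∤⇒coprime p-prime p∤n (d∣p , d∣n) with prime⇒irreducible p-prime d∣p
... | inj₁ d≡1  = d≡1
... | inj₂ refl = contradiction d∣n p∤n

coprime-summands : ∀ {p a b} → Prime p → a + b ≡ p → ¬ (p ∣ a × p ∣ b) → Coprime a b
coprime-summands p-prime a+b≡p ¬p∣a,b {k} (k∣a , k∣b)
  with prime⇒irreducible p-prime (subst (k ∣_) a+b≡p (∣m∣n⇒∣m+n k∣a k∣b))
... | inj₁ k≡1  = k≡1
... | inj₂ refl = contradiction (k∣a , k∣b) ¬p∣a,b

prime∣square⇒∣ : ∀ {p n} → Prime p → p ∣ n * n → p ∣ n
prime∣square⇒∣ {n = n} p-prime p∣n² = [ id , id ]′ (euclidsLemma n n p-prime p∣n²)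

prime∣scaled-square⇒∣ : ∀ {p m n} → Prime p → ¬ p ∣ m → p ∣ m * (n * n) → p ∣ n
prime∣scaled-square⇒∣ {m = m} {n} p-prime p∤m p∣mn² with euclidsLemma m (n * n) p-prime p∣mn²
... | inj₁ p∣m  = contradiction p∣m p∤m
... | inj₂ p∣n² = prime∣square⇒∣ p-prime p∣n²

3∣m*n∧3∤n⇒3∣m : ∀ {m n} → 3 ∣ m * n → ¬ 3 ∣ n → 3 ∣ m
3∣m*n∧3∤n⇒3∣m {m} {n} 3∣mn 3∤n =
  [ id , (λ 3∣n → contradiction 3∣n 3∤n) ]′ (euclidsLemma m n prime[3] 3∣mn)

prime>3⇒coprime-6 : ∀ {p} → Prime p → 3 < p → Coprime p 6
prime>3⇒coprime-6 p-prime 3<p =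
  coprime-*ʳ {n = 2} (prime⇒coprime p-prime (<-trans (from-yes (2 <? 3)) 3<p)) (prime⇒coprime p-prime 3<p)

prime>3⇒∤-divisor-of-216 : ∀ {p m} → Prime p → 3 < p → m ∣ 216 → ¬ p ∣ m
prime>3⇒∤-divisor-of-216 {p} p-prime 3<p m∣216 p∣m = prime⇒≢1 p-prime (p⊥6³ (∣-refl , ∣-trans p∣m m∣216))
  where
  p⊥6 : Coprime p 6
  p⊥6 = prime>3⇒coprime-6 p-prime 3<p
  p⊥6³ : Coprime p (6 * (6 * 6))
  p⊥6³ = coprime-*ʳ p⊥6 (coprime-*ʳ p⊥6 p⊥6)

prime>3⇒odd : ∀ {p} → Prime p → 3 < p → ¬ 2 ∣ p
prime>3⇒odd p-prime 3<p 2∣p with prime>3⇒coprime-6 p-prime 3<p (2∣p , divides 3 refl)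
... | ()

-- a′ ⊥ n′ forces a′ ∣ g, say g = c a′; then a = a′² c and b = n′² c, so c ∣ gcd a b = 1.
coprime-product-square⇒square-of-factor : ∀ {a b n a′ n′ g} .{{_ : NonZero a′}} .{{_ : NonZero g}} →
  Coprime a b → Coprime a′ n′ → a ≡ a′ * g → n ≡ n′ * g → a * b ≡ n * n → a ≡ a′ * a′
coprime-product-square⇒square-of-factor {a} {b} {n} {a′} {n′} {g} a⊥b a′⊥n′ a≡a′g n≡n′g ab≡n² =
  trans a≡a′²c (trans (cong (a′ * a′ *_) c≡1) (*-identityʳ _))
  where
  open ≡-Reasoning
  a′b≡n′²g : a′ * b ≡ n′ * (n′ * g)
  a′b≡n′²g = *-cancelʳ-≡ _ _ g (begin
    a′ * b * g           ≡⟨ x*y*z≡x*z*y a′ b g ⟩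
    a′ * g * b           ≡⟨ cong (_* b) a≡a′g ⟨
    a * b                ≡⟨ ab≡n² ⟩
    n * n                ≡⟨ cong₂ _*_ n≡n′g n≡n′g ⟩
    n′ * g * (n′ * g)    ≡⟨ x*y*[x*y]≡x*[x*y]*y n′ g ⟩
    n′ * (n′ * g) * g    ∎)
    where
    x*y*z≡x*z*y : ∀ x y z → x * y * z ≡ x * z * y
    x*y*z≡x*z*y = solve-∀
    x*y*[x*y]≡x*[x*y]*y : ∀ x y → x * y * (x * y) ≡ x * (x * y) * y
    x*y*[x*y]≡x*[x*y]*y = solve-∀

  a′∣g : a′ ∣ g
  a′∣g = coprime-divisor a′⊥n′ (coprime-divisor a′⊥n′
    (divides b (trans (sym a′b≡n′²g) (*-comm a′ b))))

  c = quotient a′∣g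

  g≡ca′ : g ≡ c * a′
  g≡ca′ = m∣n⇒n≡quotient*m a′∣g

  a≡a′²c : a ≡ a′ * a′ * c
  a≡a′²c = trans a≡a′g (trans (cong (a′ *_) g≡ca′) (x*[y*x]≡x*x*y a′ c))
    where
    x*[y*x]≡x*x*y : ∀ x y → x * (y * x) ≡ x * x * y
    x*[y*x]≡x*x*y = solve-∀

  b≡n′²c : b ≡ n′ * n′ * c
  b≡n′²c = *-cancelˡ-≡ _ _ a′ (begin
    a′ * b                 ≡⟨ a′b≡n′²g ⟩
    n′ * (n′ * g)          ≡⟨ cong (λ g → n′ * (n′ * g)) g≡ca′ ⟩
    n′ * (n′ * (c * a′))   ≡⟨ x*[x*[y*z]]≡z*[x*x*y] n′ c a′ ⟩
    a′ * (n′ * n′ * c)     ∎)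
    where
    x*[x*[y*z]]≡z*[x*x*y] : ∀ x y z → x * (x * (y * z)) ≡ z * (x * x * y)
    x*[x*[y*z]]≡z*[x*x*y] = solve-∀

  c≡1 : c ≡ 1
  c≡1 = a⊥b (divides (a′ * a′) a≡a′²c , divides (n′ * n′) b≡n′²c)

coprime-product-square⇒square : ∀ {a b} n → Coprime a b → a * b ≡ n * n → ∃[ s ] a ≡ s * s
coprime-product-square⇒square {zero}        n _   _     = 0 , refl
coprime-product-square⇒square {a@(suc _)} n a⊥b ab≡n² =
  a / g , coprime-product-square⇒square-of-factor a⊥b (coprime-/gcd a n) a≡a′g n≡n′g ab≡n²
  where
  g = gcd a n
  instance
    g≢0 : NonZero g
    g≢0 = ≢-nonZero (gcd[m,n]≢0 a n (inj₁ λ ()))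

  a≡a′g : a ≡ a / g * g
  a≡a′g = sym (m/n*n≡m (gcd[m,n]∣m a n))

  n≡n′g : n ≡ n / g * g
  n≡n′g = sym (m/n*n≡m (gcd[m,n]∣n a n))

  instance
    a′≢0 : NonZero (a / g)
    a′≢0 = ≢-nonZero λ a′≡0 → 0≢1+n (sym (trans a≡a′g (cong (_* g) a′≡0)))

difference-square-≤ : ∀ {A B} → A ≤ B → ∃[ X ] (X * X + 4 * (A * B) ≡ (A + B) * (A + B)) × X + A ≡ B
difference-square-≤ {A} A≤B with m≤n⇒∃[o]m+o≡n A≤B
... | X , refl = X , identity X A , +-comm X A
  where
  identity : ∀ X A → X * X + 4 * (A * (A + X)) ≡ (A + (A + X)) * (A + (A + X))
  identity = solve-∀

difference-square : ∀ A B → ∃[ X ] (X * X + 4 * (A * B) ≡ (A + B) * (A + B)) × (X + A ≡ B ⊎ X + B ≡ A)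
difference-square A B with ≤-total A B
... | inj₁ A≤B = let X , eq , X+A≡B = difference-square-≤ A≤B in X , eq , inj₁ X+A≡B
... | inj₂ B≤A = let X , eq , X+B≡A = difference-square-≤ B≤A in
  X , subst₂ (λ AB A+B → X * X + 4 * AB ≡ A+B * A+B) (*-comm B A) (+-comm B A) eq , inj₂ X+B≡A

coprime-difference : ∀ {X A B} → Coprime A B → X + A ≡ B ⊎ X + B ≡ A → Coprime X A
coprime-difference A⊥B (inj₁ X+A≡B) (d∣X , d∣A) = A⊥B (d∣A , subst (_ ∣_) X+A≡B (∣m∣n⇒∣m+n d∣X d∣A))
coprime-difference A⊥B (inj₂ X+B≡A) (d∣X , d∣A) = A⊥B (d∣A , ∣m+n∣m⇒∣n (subst (_ ∣_) (sym X+B≡A) d∣A) d∣X)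

square-of-primitive-rep : ∀ {p α β u v} → Prime p → ¬ 2 ∣ p → ¬ p ∣ α → ¬ p ∣ β → Coprime u v →
  α * (u * u) + β * (v * v) ≡ p →
  ∃[ X ] (1 * (X * X) + 4 * α * β * ((u * v) * (u * v)) ≡ p * p) × Coprime X (2 * (u * v))
square-of-primitive-rep {p} {α} {β} {u} {v} p-prime p-odd p∤α p∤β u⊥v A+B≡p
  with difference-square (α * (u * u)) (β * (v * v))
... | X , X²+4AB≡[A+B]² , X+A≡B⊎X+B≡A =
  X , trans (regroup X α β u v) X²+4AB≡p² , coprime-*ʳ X⊥2 (coprime-*ʳ X⊥u X⊥v)
  where
  A = α * (u * u)
  B = β * (v * v)

  regroup : ∀ X α β u v → 1 * (X * X) + 4 * α * β * ((u * v) * (u * v))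
                        ≡ X * X + 4 * (α * (u * u) * (β * (v * v)))
  regroup = solve-∀

  X²+4AB≡p² : X * X + 4 * (A * B) ≡ p * p
  X²+4AB≡p² = subst (λ n → X * X + 4 * (A * B) ≡ n * n) A+B≡p X²+4AB≡[A+B]²

  A⊥B : Coprime A B
  A⊥B = coprime-summands p-prime A+B≡p λ (p∣A , p∣B) →
    prime⇒≢1 p-prime (u⊥v (prime∣scaled-square⇒∣ p-prime p∤α p∣A ,
                           prime∣scaled-square⇒∣ p-prime p∤β p∣B))

  X⊥u : Coprime X u
  X⊥u = coprime-∣ (coprime-difference A⊥B X+A≡B⊎X+B≡A) ∣-refl (∣n⇒∣m*n α (m∣m*n u))

  X⊥v : Coprime X v
  X⊥v = coprime-∣ (coprime-difference (Coprime.sym A⊥B) (swap X+A≡B⊎X+B≡A)) ∣-refl (∣n⇒∣m*n β (m∣m*n v))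

  X⊥2 : Coprime X 2
  X⊥2 = Coprime.sym (prime∤⇒coprime prime[2] λ 2∣X →
    p-odd (prime∣square⇒∣ prime[2] (subst (2 ∣_) X²+4AB≡p²
      (∣m∣n⇒∣m+n (∣m⇒∣m*n X 2∣X) (∣m⇒∣m*n (A * B) (divides 2 refl))))))

x²+2ky²≡2n⇒2∣x : ∀ k {x y n} → 1 * (x * x) + 2 * k * (y * y) ≡ 2 * n → 2 ∣ x
x²+2ky²≡2n⇒2∣x k {x} {y} {n} eq = prime∣square⇒∣ prime[2] (subst (2 ∣_) (*-identityˡ (x * x)) 2∣x²)
  where
  2∣x² : 2 ∣ 1 * (x * x)
  2∣x² = ∣m+n∣m⇒∣n (subst (2 ∣_) (trans (sym eq) (+-comm (1 * (x * x)) _)) (m∣m*n {2} n))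
                   (∣m⇒∣m*n (y * y) (m∣m*n {2} k))

x²+216y²≡4n⇒x²+54y²≡n : ∀ {n} → PrimitiveRep 1 216 (4 * n) → PrimitiveRep 1 54 n
x²+216y²≡4n⇒x²+54y²≡n {n} (x , y , eq , x⊥y) =
  u , y , *-cancelˡ-≡ _ _ 4 (trans (expand u y) (subst (λ x → 1 * (x * x) + 216 * (y * y) ≡ 4 * n) x≡u*2 eq)) ,
  coprime-∣ x⊥y (subst (u ∣_) (sym x≡u*2) (m∣m*n 2)) ∣-refl
  where
  2∣x : 2 ∣ x
  2∣x = x²+2ky²≡2n⇒2∣x 108 {x} {y} {2 * n} (trans eq (*-assoc 2 2 n))
  u = quotient 2∣x
  x≡u*2 : x ≡ u * 2
  x≡u*2 = m∣n⇒n≡quotient*m 2∣x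
  expand : ∀ u y → 4 * (1 * (u * u) + 54 * (y * y)) ≡ 1 * (u * 2 * (u * 2)) + 216 * (y * y)
  expand = solve-∀

x²+54y²≡2n⇒2x²+27y²≡n : ∀ {n} → PrimitiveRep 1 54 (2 * n) → PrimitiveRep 2 27 n
x²+54y²≡2n⇒2x²+27y²≡n {n} (x , y , eq , x⊥y) =
  w , y , *-cancelˡ-≡ _ _ 2 (trans (expand w y) (subst (λ x → 1 * (x * x) + 54 * (y * y) ≡ 2 * n) x≡w*2 eq)) ,
  coprime-∣ x⊥y (subst (w ∣_) (sym x≡w*2) (m∣m*n 2)) ∣-refl
  where
  2∣x : 2 ∣ x
  2∣x = x²+2ky²≡2n⇒2∣x 27 {x} {y} {n} eq
  w = quotient 2∣x
  x≡w*2 : x ≡ w * 2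
  x≡w*2 = m∣n⇒n≡quotient*m 2∣x
  expand : ∀ w y → 2 * (2 * (w * w) + 27 * (y * y)) ≡ 1 * (w * 2 * (w * 2)) + 54 * (y * y)
  expand = solve-∀

x²+216y²≡8n⇒2x²+27y²≡n : ∀ {n} → PrimitiveRep 1 216 (8 * n) → PrimitiveRep 2 27 n
x²+216y²≡8n⇒2x²+27y²≡n {n} rep =
  x²+54y²≡2n⇒2x²+27y²≡n (x²+216y²≡4n⇒x²+54y²≡n (subst (PrimitiveRep 1 216) (*-assoc 4 2 n) rep))

x²+54y²≡n⇒x²+216y²≡n∨4n : ∀ {n} → PrimitiveRep 1 54 n → PrimitiveRep 1 216 n ⊎ PrimitiveRep 1 216 (4 * n)
x²+54y²≡n⇒x²+216y²≡n∨4n (t , s , eq , t⊥s) with 2 ∣? s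
... | yes (divides k refl) = inj₁ (t , k , trans (halve t k) eq , coprime-∣ t⊥s ∣-refl (m∣m*n 2))
  where
  halve : ∀ t k → 1 * (t * t) + 216 * (k * k) ≡ 1 * (t * t) + 54 * (k * 2 * (k * 2))
  halve = solve-∀
... | no 2∤s =
  inj₂ (2 * t , s , trans (expand t s) (cong (4 *_) eq) , Coprime.sym (coprime-*ʳ s⊥2 (Coprime.sym t⊥s)))
  where
  s⊥2 : Coprime s 2
  s⊥2 = Coprime.sym (prime∤⇒coprime prime[2] 2∤s)
  expand : ∀ t s → 1 * (2 * t * (2 * t)) + 216 * (s * s) ≡ 4 * (1 * (t * t) + 54 * (s * s))
  expand = solve-∀

2x²+27y²≡n⇒x²+216y²≡8n : ∀ {n} → ¬ 2 ∣ n → PrimitiveRep 2 27 n → PrimitiveRep 1 216 (8 * n)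
2x²+27y²≡n⇒x²+216y²≡8n {n} n-odd (s , t , eq , s⊥t) =
  2 * (2 * s) , t , trans (expand s t) (cong (8 *_) eq) ,
  Coprime.sym (coprime-*ʳ t⊥2 (coprime-*ʳ t⊥2 (Coprime.sym s⊥t)))
  where
  t⊥2 : Coprime t 2
  t⊥2 = Coprime.sym (prime∤⇒coprime prime[2] λ 2∣t →
    n-odd (subst (2 ∣_) eq (∣m∣n⇒∣m+n (m∣m*n (s * s)) (∣n⇒∣m*n 27 (∣m⇒∣m*n t 2∣t)))))
  expand : ∀ s t → 1 * (2 * (2 * s) * (2 * (2 * s))) + 216 * (t * t) ≡ 8 * (2 * (s * s) + 27 * (t * t))
  expand = solve-∀

m*m≤n*n⇒m≤n : ∀ {m n} → m * m ≤ n * n → m ≤ n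
m*m≤n*n⇒m≤n m²≤n² = ≮⇒≥ λ n<m → <⇒≱ (*-mono-< n<m n<m) m²≤n²

2∣m*[m+2n]⇒2∣m : ∀ m n → 2 ∣ m * (m + n * 2) → 2 ∣ m
2∣m*[m+2n]⇒2∣m m n 2∣m[m+2n] with euclidsLemma m (m + n * 2) prime[2] 2∣m[m+2n]
... | inj₁ 2∣m    = 2∣m
... | inj₂ 2∣m+2n = ∣m+n∣m⇒∣n (subst (2 ∣_) (+-comm m _) 2∣m+2n) (n∣m*n n)

x²+216y²≡[x+d]²⇒d[d+2x]≡216y² : ∀ {X d Y} → 1 * (X * X) + 216 * (Y * Y) ≡ (X + d) * (X + d) →
  d * (d + X * 2) ≡ 216 * (Y * Y)
x²+216y²≡[x+d]²⇒d[d+2x]≡216y² {X} {d} {Y} eq = +-cancelˡ-≡ (X * X) _ _ (begin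
  X * X + d * (d + X * 2)        ≡⟨ expand X d ⟨
  (X + d) * (X + d)              ≡⟨ eq ⟨
  1 * (X * X) + 216 * (Y * Y)    ≡⟨ cong (_+ 216 * (Y * Y)) (*-identityˡ (X * X)) ⟩
  X * X + 216 * (Y * Y)          ∎)
  where
  open ≡-Reasoning
  expand : ∀ X d → (X + d) * (X + d) ≡ X * X + d * (d + X * 2)
  expand = solve-∀

x²+216y²≡[x+2b]²⇒[x+b]b≡54y² : ∀ {X b Y} → 1 * (X * X) + 216 * (Y * Y) ≡ (X + b * 2) * (X + b * 2) →
  (X + b) * b ≡ 54 * (Y * Y)
x²+216y²≡[x+2b]²⇒[x+b]b≡54y² {X} {b} {Y} eq = *-cancelˡ-≡ _ _ 4 (begin
  4 * ((X + b) * b)          ≡⟨ regroup X b ⟩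
  b * 2 * (b * 2 + X * 2)    ≡⟨ x²+216y²≡[x+d]²⇒d[d+2x]≡216y² {X} {b * 2} {Y} eq ⟩
  216 * (Y * Y)              ≡⟨ *-assoc 4 54 (Y * Y) ⟩
  4 * (54 * (Y * Y))         ∎)
  where
  open ≡-Reasoning
  regroup : ∀ X b → 4 * ((X + b) * b) ≡ b * 2 * (b * 2 + X * 2)
  regroup = solve-∀

-- a = (p + X)/2 and b = (p − X)/2
x²+216y²≡p²⇒coprime-split : ∀ {p X Y} → Prime p → ¬ p ∣ 54 →
  1 * (X * X) + 216 * (Y * Y) ≡ p * p → Coprime X Y →
  ∃[ a ] ∃[ b ] (a + b ≡ p) × (a * b ≡ 54 * (Y * Y)) × Coprime a b
x²+216y²≡p²⇒coprime-split {p} {X} {Y} p-prime p∤54 eq X⊥Y = X + b , b , a+b≡p , ab≡54Y² , a⊥b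
  where
  X≤p : X ≤ p
  X≤p = m*m≤n*n⇒m≤n (subst (_≤ p * p) (*-identityˡ (X * X)) (subst (1 * (X * X) ≤_) eq (m≤m+n _ _)))

  d = proj₁ (m≤n⇒∃[o]m+o≡n X≤p)

  X+d≡p : X + d ≡ p
  X+d≡p = proj₂ (m≤n⇒∃[o]m+o≡n X≤p)

  eq-d : 1 * (X * X) + 216 * (Y * Y) ≡ (X + d) * (X + d)
  eq-d = trans eq (cong (λ p → p * p) (sym X+d≡p))

  2∣d : 2 ∣ d
  2∣d = 2∣m*[m+2n]⇒2∣m d X (subst (2 ∣_) (sym (x²+216y²≡[x+d]²⇒d[d+2x]≡216y² {X} {d} {Y} eq-d))
                                           (∣m⇒∣m*n (Y * Y) (divides 108 refl)))

  b = quotient 2∣d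

  d≡b*2 : d ≡ b * 2
  d≡b*2 = m∣n⇒n≡quotient*m 2∣d

  a+b≡p : X + b + b ≡ p
  a+b≡p = trans (regroup X b) (trans (cong (λ d → X + d) (sym d≡b*2)) X+d≡p)
    where
    regroup : ∀ X b → X + b + b ≡ X + b * 2
    regroup = solve-∀

  ab≡54Y² : (X + b) * b ≡ 54 * (Y * Y)
  ab≡54Y² = x²+216y²≡[x+2b]²⇒[x+b]b≡54y² {X} {b} {Y}
    (subst (λ d → 1 * (X * X) + 216 * (Y * Y) ≡ (X + d) * (X + d)) d≡b*2 eq-d)

  a⊥b : Coprime (X + b) b
  a⊥b = coprime-summands p-prime a+b≡p λ (p∣a , p∣b) →
    prime⇒≢1 p-prime (X⊥Y (∣m+n∣m⇒∣n (subst (p ∣_) (+-comm X b) p∣a) p∣b ,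
                           prime∣scaled-square⇒∣ p-prime p∤54 (subst (p ∣_) ab≡54Y² (∣m⇒∣m*n b p∣a))))

coprime-product-9-square : ∀ {a b} Y → Coprime a b → a * b ≡ (3 * Y) * (3 * Y) → ¬ 3 ∣ b →
  ∃[ s ] ∃[ t ] (a ≡ 9 * (s * s)) × (b ≡ t * t)
coprime-product-9-square {a} {b} Y a⊥b ab≡[3Y]² 3∤b = quotient 3∣s₀ , t , a≡9s² , b≡t²
  where
  s₀ = proj₁ (coprime-product-square⇒square (3 * Y) a⊥b ab≡[3Y]²)

  a≡s₀² : a ≡ s₀ * s₀
  a≡s₀² = proj₂ (coprime-product-square⇒square (3 * Y) a⊥b ab≡[3Y]²)

  t = proj₁ (coprime-product-square⇒square (3 * Y) (Coprime.sym a⊥b) (trans (*-comm b a) ab≡[3Y]²))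

  b≡t² : b ≡ t * t
  b≡t² = proj₂ (coprime-product-square⇒square (3 * Y) (Coprime.sym a⊥b) (trans (*-comm b a) ab≡[3Y]²))

  3∣s₀ : 3 ∣ s₀
  3∣s₀ = prime∣square⇒∣ prime[3] (subst (3 ∣_) a≡s₀²
    (3∣m*n∧3∤n⇒3∣m (subst (3 ∣_) (sym ab≡[3Y]²) (∣m⇒∣m*n (3 * Y) (m∣m*n Y))) 3∤b))

  a≡9s² : a ≡ 9 * (quotient 3∣s₀ * quotient 3∣s₀)
  a≡9s² = trans a≡s₀² (trans (cong (λ s₀ → s₀ * s₀) (m∣n⇒n≡quotient*m 3∣s₀))
                             (regroup (quotient 3∣s₀)))
    where
    regroup : ∀ s → s * 3 * (s * 3) ≡ 9 * (s * s)
    regroup = solve-∀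

2∣n∧3∣n⇒6∣n : ∀ {n} → 2 ∣ n → 3 ∣ n → 6 ∣ n
2∣n∧3∣n⇒6∣n (divides m refl) 3∣n = *-pres-∣ (3∣m*n∧3∤n⇒3∣m {m} 3∣n (from-no (3 ∣? 2))) (∣-refl {2})

coprime-product-54-square-6∣ : ∀ {a b} Y → Coprime a b → a * b ≡ 54 * (Y * Y) → 6 ∣ a →
  PrimitiveRep 1 54 (a + b)
coprime-product-54-square-6∣ {a} {b} Y a⊥b ab≡54Y² 6∣a =
  t , s , sym a+b≡t²+54s² , coprime-∣ (Coprime.sym a⊥b) t∣b s∣a
  where
  open ≡-Reasoning
  a₁ = quotient 6∣a

  a≡a₁*6 : a ≡ a₁ * 6
  a≡a₁*6 = m∣n⇒n≡quotient*m 6∣a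

  a₁b≡[3Y]² : a₁ * b ≡ (3 * Y) * (3 * Y)
  a₁b≡[3Y]² = *-cancelˡ-≡ _ _ 6 (begin
    6 * (a₁ * b)              ≡⟨ regroup a₁ b ⟩
    a₁ * 6 * b                ≡⟨ cong (_* b) a≡a₁*6 ⟨
    a * b                     ≡⟨ ab≡54Y² ⟩
    54 * (Y * Y)              ≡⟨ regroup′ Y ⟩
    6 * (3 * Y * (3 * Y))     ∎)
    where
    regroup : ∀ a₁ b → 6 * (a₁ * b) ≡ a₁ * 6 * b
    regroup = solve-∀
    regroup′ : ∀ Y → 54 * (Y * Y) ≡ 6 * (3 * Y * (3 * Y))
    regroup′ = solve-∀

  a₁⊥b : Coprime a₁ b
  a₁⊥b = coprime-∣ a⊥b (subst (a₁ ∣_) (sym a≡a₁*6) (m∣m*n 6)) ∣-refl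

  3∤b : ¬ 3 ∣ b
  3∤b 3∣b = contradiction (a⊥b (∣-trans (divides 2 refl) 6∣a , 3∣b)) λ ()

  decomposition = coprime-product-9-square Y a₁⊥b a₁b≡[3Y]² 3∤b
  s = proj₁ decomposition
  t = proj₁ (proj₂ decomposition)

  a≡54s² : a ≡ 54 * (s * s)
  a≡54s² = trans a≡a₁*6 (trans (cong (_* 6) (proj₁ (proj₂ (proj₂ decomposition)))) (regroup s))
    where
    regroup : ∀ s → 9 * (s * s) * 6 ≡ 54 * (s * s)
    regroup = solve-∀

  b≡t² : b ≡ t * t
  b≡t² = proj₂ (proj₂ (proj₂ decomposition))

  s∣a : s ∣ a
  s∣a = subst (s ∣_) (sym a≡54s²) (∣n⇒∣m*n 54 (m∣m*n s))

  t∣b : t ∣ b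
  t∣b = subst (t ∣_) (sym b≡t²) (m∣m*n t)

  a+b≡t²+54s² : a + b ≡ 1 * (t * t) + 54 * (s * s)
  a+b≡t²+54s² = trans (cong₂ _+_ a≡54s² b≡t²) (regroup s t)
    where
    regroup : ∀ s t → 54 * (s * s) + t * t ≡ 1 * (t * t) + 54 * (s * s)
    regroup = solve-∀

coprime-product-54-square-2∣-3∣ : ∀ {a b} Y → Coprime a b → a * b ≡ 54 * (Y * Y) → 2 ∣ a → 3 ∣ b →
  PrimitiveRep 2 27 (a + b)
coprime-product-54-square-2∣-3∣ {a} {b} Y a⊥b ab≡54Y² 2∣a 3∣b =
  s , t , sym (cong₂ _+_ a≡2s² b≡27t²) , coprime-∣ a⊥b s∣a t∣b
  where
  open ≡-Reasoning
  a₂ = quotient 2∣a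
  b₁ = quotient 3∣b

  a≡a₂*2 : a ≡ a₂ * 2
  a≡a₂*2 = m∣n⇒n≡quotient*m 2∣a

  b≡b₁*3 : b ≡ b₁ * 3
  b≡b₁*3 = m∣n⇒n≡quotient*m 3∣b

  b₁a₂≡[3Y]² : b₁ * a₂ ≡ (3 * Y) * (3 * Y)
  b₁a₂≡[3Y]² = *-cancelˡ-≡ _ _ 6 (begin
    6 * (b₁ * a₂)             ≡⟨ regroup b₁ a₂ ⟩
    a₂ * 2 * (b₁ * 3)         ≡⟨ cong₂ _*_ a≡a₂*2 b≡b₁*3 ⟨
    a * b                     ≡⟨ ab≡54Y² ⟩
    54 * (Y * Y)              ≡⟨ regroup′ Y ⟩
    6 * (3 * Y * (3 * Y))     ∎)
    where
    regroup : ∀ b₁ a₂ → 6 * (b₁ * a₂) ≡ a₂ * 2 * (b₁ * 3)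
    regroup = solve-∀
    regroup′ : ∀ Y → 54 * (Y * Y) ≡ 6 * (3 * Y * (3 * Y))
    regroup′ = solve-∀

  a₂∣a : a₂ ∣ a
  a₂∣a = subst (a₂ ∣_) (sym a≡a₂*2) (m∣m*n 2)

  b₁⊥a₂ : Coprime b₁ a₂
  b₁⊥a₂ = coprime-∣ (Coprime.sym a⊥b) (subst (b₁ ∣_) (sym b≡b₁*3) (m∣m*n 3)) a₂∣a

  3∤a₂ : ¬ 3 ∣ a₂
  3∤a₂ 3∣a₂ = contradiction (a⊥b (∣-trans 3∣a₂ a₂∣a , 3∣b)) λ ()

  decomposition = coprime-product-9-square Y b₁⊥a₂ b₁a₂≡[3Y]² 3∤a₂
  t = proj₁ decomposition
  s = proj₁ (proj₂ decomposition)

  b≡27t² : b ≡ 27 * (t * t)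
  b≡27t² = trans b≡b₁*3 (trans (cong (_* 3) (proj₁ (proj₂ (proj₂ decomposition)))) (regroup t))
    where
    regroup : ∀ t → 9 * (t * t) * 3 ≡ 27 * (t * t)
    regroup = solve-∀

  a≡2s² : a ≡ 2 * (s * s)
  a≡2s² = trans a≡a₂*2 (trans (cong (_* 2) (proj₂ (proj₂ (proj₂ decomposition)))) (*-comm (s * s) 2))

  s∣a : s ∣ a
  s∣a = subst (s ∣_) (sym a≡2s²) (∣n⇒∣m*n 2 (m∣m*n s))

  t∣b : t ∣ b
  t∣b = subst (t ∣_) (sym b≡27t²) (∣n⇒∣m*n 27 (m∣m*n t))

coprime-product-54-square-2∣ : ∀ {a b} Y → Coprime a b → a * b ≡ 54 * (Y * Y) → 2 ∣ a →
  PrimitiveRep 1 54 (a + b) ⊎ PrimitiveRep 2 27 (a + b)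
coprime-product-54-square-2∣ {a} {b} Y a⊥b ab≡54Y² 2∣a =
  [ (λ 3∣a → inj₁ (coprime-product-54-square-6∣ Y a⊥b ab≡54Y² (2∣n∧3∣n⇒6∣n 2∣a 3∣a)))
  , (λ 3∣b → inj₂ (coprime-product-54-square-2∣-3∣ Y a⊥b ab≡54Y² 2∣a 3∣b))
  ]′ (euclidsLemma a b prime[3] (subst (3 ∣_) (sym ab≡54Y²) (∣m⇒∣m*n (Y * Y) (divides 18 refl))))

coprime-product-54-square : ∀ {a b} Y → Coprime a b → a * b ≡ 54 * (Y * Y) →
  PrimitiveRep 1 54 (a + b) ⊎ PrimitiveRep 2 27 (a + b)
coprime-product-54-square {a} {b} Y a⊥b ab≡54Y² =
  [ coprime-product-54-square-2∣ Y a⊥b ab≡54Y²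
  , (λ 2∣b → subst (λ n → PrimitiveRep 1 54 n ⊎ PrimitiveRep 2 27 n) (+-comm b a)
       (coprime-product-54-square-2∣ Y (Coprime.sym a⊥b) (trans (*-comm b a) ab≡54Y²) 2∣b))
  ]′ (euclidsLemma a b prime[2] (subst (2 ∣_) (sym ab≡54Y²) (∣m⇒∣m*n (Y * Y) (divides 27 refl))))

x²+216y²≡p²⇒x²+54y²∨2x²+27y²≡p : ∀ {p} → Prime p → 3 < p → PrimitiveRep 1 216 (p * p) →
  PrimitiveRep 1 54 p ⊎ PrimitiveRep 2 27 p
x²+216y²≡p²⇒x²+54y²∨2x²+27y²≡p p-prime 3<p (X , Y , eq , X⊥Y) =
  let a , b , a+b≡p , ab≡54Y² , a⊥b =
        x²+216y²≡p²⇒coprime-split p-prime (prime>3⇒∤-divisor-of-216 p-prime 3<p (divides 4 refl)) eq X⊥Y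
  in subst (λ n → PrimitiveRep 1 54 n ⊎ PrimitiveRep 2 27 n) a+b≡p (coprime-product-54-square Y a⊥b ab≡54Y²)

ReducedRep : ℕ → Set
ReducedRep n = PrimitiveRep 1 216 n ⊎ PrimitiveRep 1 54 n ⊎ PrimitiveRep 2 27 n

reducedRep⇒x²+216y²≡p² : ∀ {p} → Prime p → 3 < p → ReducedRep p → PrimitiveRep 1 216 (p * p)
reducedRep⇒x²+216y²≡p² {p} p-prime 3<p = [ from-216 , [ from-54 , from-27 ]′ ]′
  where
  p-odd : ¬ 2 ∣ p
  p-odd = prime>3⇒odd p-prime 3<p

  p∤ : ∀ {m} → m ∣ 216 → ¬ p ∣ m
  p∤ = prime>3⇒∤-divisor-of-216 p-prime 3<p

  from-216 : PrimitiveRep 1 216 p → PrimitiveRep 1 216 (p * p)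
  from-216 (u , v , eq , u⊥v) =
    let X , eqX , X⊥2uv =
          square-of-primitive-rep {α = 1} {216} p-prime p-odd (p∤ (1∣ 216)) (p∤ ∣-refl) u⊥v eq
    in X , 2 * (u * v) , trans (regroup X u v) eqX , X⊥2uv
    where
    regroup : ∀ X u v → 1 * (X * X) + 216 * (2 * (u * v) * (2 * (u * v)))
                      ≡ 1 * (X * X) + 4 * 1 * 216 * (u * v * (u * v))
    regroup = solve-∀

  from-54 : PrimitiveRep 1 54 p → PrimitiveRep 1 216 (p * p)
  from-54 (u , v , eq , u⊥v) =
    let X , eqX , X⊥2uv =
          square-of-primitive-rep {α = 1} {54} p-prime p-odd (p∤ (1∣ 216)) (p∤ (divides 4 refl)) u⊥v eq
    in X , u * v , eqX , coprime-∣ X⊥2uv ∣-refl (n∣m*n 2)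

  from-27 : PrimitiveRep 2 27 p → PrimitiveRep 1 216 (p * p)
  from-27 (u , v , eq , u⊥v) =
    let X , eqX , X⊥2uv =
          square-of-primitive-rep {α = 2} {27} p-prime p-odd (p∤ (divides 108 refl)) (p∤ (divides 8 refl)) u⊥v eq
    in X , u * v , eqX , coprime-∣ X⊥2uv ∣-refl (n∣m*n 2)

𝒫-condition : ℕ → Set
𝒫-condition n = PrimitiveRep 1 216 n ⊎ PrimitiveRep 1 216 (4 * n) ⊎ PrimitiveRep 1 216 (8 * n)

𝒫-condition⇒reducedRep : ∀ {n} → 𝒫-condition n → ReducedRep n
𝒫-condition⇒reducedRep = Sum.map₂ (Sum.map x²+216y²≡4n⇒x²+54y²≡n x²+216y²≡8n⇒2x²+27y²≡n)

x²+54y²∨2x²+27y²⇒𝒫-condition : ∀ {n} → ¬ 2 ∣ n →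
  PrimitiveRep 1 54 n ⊎ PrimitiveRep 2 27 n → 𝒫-condition n
x²+54y²∨2x²+27y²⇒𝒫-condition n-odd (inj₁ rep) = Sum.map₂ inj₁ (x²+54y²≡n⇒x²+216y²≡n∨4n rep)
x²+54y²∨2x²+27y²⇒𝒫-condition n-odd (inj₂ rep) = inj₂ (inj₂ (2x²+27y²≡n⇒x²+216y²≡8n n-odd rep))

x²+216y²≡n⇒n≡1∨216≤n : ∀ {n} → PrimitiveRep 1 216 n → n ≡ 1 ⊎ 216 ≤ n
x²+216y²≡n⇒n≡1∨216≤n (x , zero , eq , x⊥0) =
  inj₁ (trans (sym eq) (cong (λ x → 1 * (x * x) + 216 * 0) (0-coprimeTo-m⇒m≡1 (Coprime.sym x⊥0))))
x²+216y²≡n⇒n≡1∨216≤n (x , y@(suc _) , eq , _) =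
  inj₂ (subst (216 ≤_) eq (≤-trans (m≤m*n 216 (y * y)) (m≤n+m _ (1 * (x * x)))))

x²+216y²≡n⇒3<p : ∀ {p n} → Prime p → p ∣ n → (p ≤ 3 → n < 216) → PrimitiveRep 1 216 n → 3 < p
x²+216y²≡n⇒3<p p-prime p∣n n<216 rep with x²+216y²≡n⇒n≡1∨216≤n rep
... | inj₁ refl  = contradiction (∣1⇒≡1 p∣n) (prime⇒≢1 p-prime)
... | inj₂ 216≤n = ≰⇒> λ p≤3 → <⇒≱ (n<216 p≤3) 216≤n

𝒫-condition⇒3<p : ∀ {p} → Prime p → 𝒫-condition p → 3 < p
𝒫-condition⇒3<p p-prime (inj₁ rep) =
  x²+216y²≡n⇒3<p p-prime ∣-refl (λ p≤3 → ≤-<-trans p≤3 (from-yes (3 <? 216))) rep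
𝒫-condition⇒3<p p-prime (inj₂ (inj₁ rep)) =
  x²+216y²≡n⇒3<p p-prime (n∣m*n 4) (λ p≤3 → ≤-<-trans (*-monoʳ-≤ 4 p≤3) (from-yes (12 <? 216))) rep
𝒫-condition⇒3<p p-prime (inj₂ (inj₂ rep)) =
  x²+216y²≡n⇒3<p p-prime (n∣m*n 8) (λ p≤3 → ≤-<-trans (*-monoʳ-≤ 8 p≤3) (from-yes (24 <? 216))) rep

x²+216y²≡p²⇒3<p : ∀ {p} → Prime p → PrimitiveRep 1 216 (p * p) → 3 < p
x²+216y²≡p²⇒3<p {p} p-prime =
  x²+216y²≡n⇒3<p p-prime (m∣m*n p) (λ p≤3 → ≤-<-trans (*-mono-≤ p≤3 p≤3) (from-yes (9 <? 216)))

proposition2p11 : (p : ℕ) → Prime p → (InP p ⇔ HasPrimSol (+ (p Data.Nat.* p)))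
proposition2p11 p p-prime = mk⇔
  (λ (_ , sols) →
    let reps = Sum.map toRep (Sum.map toRep toRep) sols
    in fromRep (reducedRep⇒x²+216y²≡p² p-prime (𝒫-condition⇒3<p p-prime reps) (𝒫-condition⇒reducedRep reps)))
  (λ sol →
    let rep = toRep sol
        3<p = x²+216y²≡p²⇒3<p p-prime rep
    in p-prime , Sum.map fromRep (Sum.map fromRep fromRep)
         (x²+54y²∨2x²+27y²⇒𝒫-condition (prime>3⇒odd p-prime 3<p)
           (x²+216y²≡p²⇒x²+54y²∨2x²+27y²≡p p-prime 3<p rep)))
  where
  toRep : ∀ {n} → HasPrimSol (+ n) → PrimitiveRep 1 216 n
  toRep {n} = Equivalence.to (hasPrimSol⇔primitiveRep n)

  fromRep : ∀ {n} → PrimitiveRep 1 216 n → HasPrimSol (+ n)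
  fromRep {n} = Equivalence.from (hasPrimSol⇔primitiveRep n)
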